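{- Let $a, b$ be positive integers and let $W(x) \in \mathbb{Q}[x]$ have at least two nonzero terms, all of whose exponents are divisible by $3$. If $W(x) \mid Q_{a,b}(x)$ or $W(x) \mid R_{a,b}(x)$, then $3 \mid a$ and $3 \mid b$.
   Context: For positive integers $a,b$: $Q_{a,b}(x) = x^{2a+b} + x^{a+2b} + x^a + x^b - x^{2a+2b} - x^{2a} - x^{2b} - 1$ and $R_{a,b}(x) = x^{2a+b} + x^{a+2b} + x^a + x^b + x^{2a+2b} + x^{2a} + x^{2b} + 1$. -}

module Defs where

open import Data.Nat using (ℕ; zero; suc; _+_; _*_)
open import Data.List using (List; []; _∷_; map; replicate; _++_; foldr)
open import Data.Rational using (ℚ; 0ℚ; 1ℚ; -_) renaming (_+_ to _+ℚ_; _*_ to _*ℚ_)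
open import Data.Product using (∃)
open import Relation.Binary.PropositionalEquality using (_≡_)

-- A polynomial in ℚ[x] is represented by its list of coefficients,
-- the i-th entry being the coefficient of x^i (trailing zeros allowed).
Poly : Set
Poly = List ℚ

coeff : Poly → ℕ → ℚ
coeff []       _       = 0ℚ
coeff (c ∷ p)  zero    = c
coeff (c ∷ p)  (suc n) = coeff p n

infixl 6 _+ₚ_
infixl 7 _*ₚ_

_+ₚ_ : Poly → Poly → Poly
[]      +ₚ q       = q
(c ∷ p) +ₚ []      = c ∷ p
(c ∷ p) +ₚ (d ∷ q) = (c +ℚ d) ∷ (p +ₚ q)

_*ₚ_ : Poly → Poly → Poly
[]      *ₚ q = []
(c ∷ p) *ₚ q = map (c *ℚ_) q +ₚ (0ℚ ∷ (p *ₚ q))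

_≈ₚ_ : Poly → Poly → Set
p ≈ₚ q = ∀ n → coeff p n ≡ coeff q n

_∣ₚ_ : Poly → Poly → Set
w ∣ₚ p = ∃ λ v → (w *ₚ v) ≈ₚ p

mono : ℚ → ℕ → Poly
mono c n = replicate n 0ℚ ++ (c ∷ [])

sumₚ : List Poly → Poly
sumₚ = foldr _+ₚ_ []

Qab : ℕ → ℕ → Poly
Qab a b = sumₚ ( mono 1ℚ (2 * a + b) ∷ mono 1ℚ (a + 2 * b) ∷ mono 1ℚ a ∷ mono 1ℚ b
               ∷ mono (- 1ℚ) (2 * a + 2 * b) ∷ mono (- 1ℚ) (2 * a) ∷ mono (- 1ℚ) (2 * b)
               ∷ mono (- 1ℚ) 0 ∷ [])

Rab : ℕ → ℕ → Poly
Rab a b = sumₚ ( mono 1ℚ (2 * a + b) ∷ mono 1ℚ (a + 2 * b) ∷ mono 1ℚ a ∷ mono 1ℚ b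
               ∷ mono 1ℚ (2 * a + 2 * b) ∷ mono 1ℚ (2 * a) ∷ mono 1ℚ (2 * b)
               ∷ mono 1ℚ 0 ∷ [])

-- Every exponent of W is a multiple of 3, so multiplying by W preserves residues
-- of exponents mod 3, and W divides each residue-class component of
--   P = x^(2a+b) + x^(a+2b) + x^a + x^b + ε (x^(2a+2b) + x^(2a) + x^(2b) + 1),
-- where ε = -1 gives Q_{a,b} and ε = 1 gives R_{a,b}. If 3 ∤ a or 3 ∤ b then,
-- depending on (a mod 3, b mod 3), an explicit combination of these components
-- collapses, using ε² = 1, to a single monomial x^(a+b), x^(2b) or x^(a+2b).
-- But a polynomial with two nonzero terms divides no monomial: the lowest and
-- the highest nonzero terms of any of its nonzero multiples have different degrees.

module Submission where

open import Algebra.Bundles using (CommutativeRing)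
open import Data.Bool using (Bool; true; false; if_then_else_; T)
open import Data.Empty using (⊥-elim)
open import Data.List using (List; []; _∷_; map; filter)
open import Data.List.Relation.Unary.All using (All; []; _∷_)
open import Data.Maybe using (Maybe; just; nothing)
open import Data.Nat using (ℕ; zero; suc; _+_; _*_; _≤_; _<_; s≤s; z≤n; _%_; _≡ᵇ_; _≟_; NonZero)
open import Data.Nat.DivMod using (m%n<n; %-remove-+ˡ; %-distribˡ-+; %-distribˡ-*)
open import Data.Nat.Divisibility using (_∣_; m%n≡0⇒n∣m)
open import Data.Nat.Properties
  using ( +-identityʳ; ≡⇒≡ᵇ; ≡ᵇ⇒≡; ≮⇒≥; m≤n+m; n<1+n; <-cmp; <-trans; ≤-<-trans; <-≤-trans
        ; <-irrefl; +-mono-≤-<)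
open import Data.Product using (_,_; _×_; ∃; proj₁; proj₂)
open import Data.Rational using (ℚ; 0ℚ; 1ℚ) renaming (_+_ to _+ℚ_; _*_ to _*ℚ_; -_ to -ℚ_)
import Data.Rational.Properties as ℚ
open import Algebra.Apartness.Properties.HeytingCommutativeRing ℚ.heytingCommutativeRing
  using (x#0y#0→xy#0)
open import Data.Sum using (_⊎_; inj₁; inj₂)
open import Function using (_∘_; _⟨_⟩_)
open import Level using (0ℓ)
open import Relation.Binary.Definitions using (tri<; tri≈; tri>)
open import Relation.Binary.PropositionalEquality
  using (_≡_; _≢_; refl; sym; trans; cong; cong₂; subst; module ≡-Reasoning)
import Relation.Binary.Reasoning.Setoid as ≈-Reasoning
open import Relation.Nullary using (¬_)
open import Relation.Nullary.Decidable using (dec⇒maybe; yes; no)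
open import Tactic.RingSolver using (solve-∀)
open import Tactic.RingSolver.Core.AlmostCommutativeRing using (AlmostCommutativeRing; fromCommutativeRing)

open import Defs

-- ℚ[x] is a commutative ring

ℚ-almostCommutativeRing : AlmostCommutativeRing 0ℓ 0ℓ
ℚ-almostCommutativeRing = fromCommutativeRing ℚ.+-*-commutativeRing (λ x → dec⇒maybe (0ℚ ℚ.≟ x))

Null : Poly → Set
Null p = ∀ n → coeff p n ≡ 0ℚ

0∷[]-null : Null (0ℚ ∷ [])
0∷[]-null zero    = refl
0∷[]-null (suc n) = refl

negₚ : Poly → Poly
negₚ = map -ℚ_

coeff-+ₚ : ∀ p q n → coeff (p +ₚ q) n ≡ coeff p n +ℚ coeff q n
coeff-+ₚ []      q       n       = sym (ℚ.+-identityˡ _)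
coeff-+ₚ (c ∷ p) []      n       = sym (ℚ.+-identityʳ _)
coeff-+ₚ (c ∷ p) (d ∷ q) zero    = refl
coeff-+ₚ (c ∷ p) (d ∷ q) (suc n) = coeff-+ₚ p q n

coeff-scale : ∀ c q n → coeff (map (c *ℚ_) q) n ≡ c *ℚ coeff q n
coeff-scale c []      n       = sym (ℚ.*-zeroʳ c)
coeff-scale c (d ∷ q) zero    = refl
coeff-scale c (d ∷ q) (suc n) = coeff-scale c q n

coeff-negₚ : ∀ p n → coeff (negₚ p) n ≡ -ℚ coeff p n
coeff-negₚ []      n       = refl
coeff-negₚ (c ∷ p) zero    = refl
coeff-negₚ (c ∷ p) (suc n) = coeff-negₚ p n

coeff-∷-*ₚ : ∀ c p q n → coeff ((c ∷ p) *ₚ q) n ≡ c *ℚ coeff q n +ℚ coeff (0ℚ ∷ p *ₚ q) n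
coeff-∷-*ₚ c p q n = trans (coeff-+ₚ (map (c *ℚ_) q) _ n) (cong (_+ℚ _) (coeff-scale c q n))

coeff-0∷-+ₚ : ∀ p q n → coeff (0ℚ ∷ p +ₚ q) n ≡ coeff (0ℚ ∷ p) n +ℚ coeff (0ℚ ∷ q) n
coeff-0∷-+ₚ p q zero    = sym (ℚ.+-identityˡ 0ℚ)
coeff-0∷-+ₚ p q (suc n) = coeff-+ₚ p q n

coeff-0∷-scale : ∀ c p n → coeff (0ℚ ∷ map (c *ℚ_) p) n ≡ c *ℚ coeff (0ℚ ∷ p) n
coeff-0∷-scale c p zero    = sym (ℚ.*-zeroʳ c)
coeff-0∷-scale c p (suc n) = coeff-scale c p n

0∷-cong : ∀ {p q} → p ≈ₚ q → (0ℚ ∷ p) ≈ₚ (0ℚ ∷ q)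
0∷-cong e zero    = refl
0∷-cong e (suc n) = e n

+ₚ-cong : ∀ {p p′ q q′} → p ≈ₚ p′ → q ≈ₚ q′ → (p +ₚ q) ≈ₚ (p′ +ₚ q′)
+ₚ-cong {p} {p′} {q} {q′} e f n =
  trans (coeff-+ₚ p q n) (trans (cong₂ _+ℚ_ (e n) (f n)) (sym (coeff-+ₚ p′ q′ n)))

+ₚ-assoc : ∀ p q r → (p +ₚ q +ₚ r) ≈ₚ (p +ₚ (q +ₚ r))
+ₚ-assoc p q r n = begin
  coeff (p +ₚ q +ₚ r) n
    ≡⟨ coeff-+ₚ (p +ₚ q) r n ⟨ trans ⟩ cong (_+ℚ coeff r n) (coeff-+ₚ p q n) ⟩
  coeff p n +ℚ coeff q n +ℚ coeff r n
    ≡⟨ ℚ.+-assoc (coeff p n) (coeff q n) (coeff r n) ⟩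
  coeff p n +ℚ (coeff q n +ℚ coeff r n)
    ≡⟨ sym (coeff-+ₚ p (q +ₚ r) n ⟨ trans ⟩ cong (coeff p n +ℚ_) (coeff-+ₚ q r n)) ⟩
  coeff (p +ₚ (q +ₚ r)) n ∎
  where open ≡-Reasoning

*ₚ-congʳ : ∀ p {q q′} → q ≈ₚ q′ → (p *ₚ q) ≈ₚ (p *ₚ q′)
*ₚ-congʳ []      e n = refl
*ₚ-congʳ (c ∷ p) {q} {q′} e n =
  trans (coeff-∷-*ₚ c p q n)
        (trans (cong₂ _+ℚ_ (cong (c *ℚ_) (e n)) (0∷-cong (*ₚ-congʳ p e) n))
               (sym (coeff-∷-*ₚ c p q′ n)))

*ₚ-zeroʳ : ∀ p → Null (p *ₚ [])
*ₚ-zeroʳ []      n       = refl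
*ₚ-zeroʳ (c ∷ p) zero    = refl
*ₚ-zeroʳ (c ∷ p) (suc n) = *ₚ-zeroʳ p n

coeff-*ₚ-∷ : ∀ p d q n → coeff (p *ₚ (d ∷ q)) n ≡ d *ℚ coeff p n +ℚ coeff (0ℚ ∷ p *ₚ q) n
coeff-*ₚ-∷ []      d q zero    = sym (trans (ℚ.+-identityʳ _) (ℚ.*-zeroʳ d))
coeff-*ₚ-∷ []      d q (suc n) = sym (trans (ℚ.+-identityʳ _) (ℚ.*-zeroʳ d))
coeff-*ₚ-∷ (c ∷ p) d q zero    = cong (_+ℚ 0ℚ) (ℚ.*-comm c d)
coeff-*ₚ-∷ (c ∷ p) d q (suc n) = begin
  coeff (map (c *ℚ_) q +ₚ p *ₚ (d ∷ q)) n
    ≡⟨ coeff-+ₚ (map (c *ℚ_) q) _ n ⟩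
  coeff (map (c *ℚ_) q) n +ℚ coeff (p *ₚ (d ∷ q)) n
    ≡⟨ cong₂ _+ℚ_ (coeff-scale c q n) (coeff-*ₚ-∷ p d q n) ⟩
  c *ℚ coeff q n +ℚ (d *ℚ coeff p n +ℚ coeff (0ℚ ∷ p *ₚ q) n)
    ≡⟨ swap (c *ℚ coeff q n) (d *ℚ coeff p n) _ ⟩
  d *ℚ coeff p n +ℚ (c *ℚ coeff q n +ℚ coeff (0ℚ ∷ p *ₚ q) n)
    ≡⟨ cong (d *ℚ coeff p n +ℚ_) (sym (coeff-∷-*ₚ c p q n)) ⟩
  d *ℚ coeff p n +ℚ coeff ((c ∷ p) *ₚ q) n ∎
  where
  open ≡-Reasoning
  swap : ∀ x y z → x +ℚ (y +ℚ z) ≡ y +ℚ (x +ℚ z)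
  swap = solve-∀ ℚ-almostCommutativeRing

*ₚ-comm : ∀ p q → (p *ₚ q) ≈ₚ (q *ₚ p)
*ₚ-comm []      q n = sym (*ₚ-zeroʳ q n)
*ₚ-comm (c ∷ p) q n =
  trans (coeff-∷-*ₚ c p q n)
        (trans (cong (c *ℚ coeff q n +ℚ_) (0∷-cong (*ₚ-comm p q) n))
               (sym (coeff-*ₚ-∷ q c p n)))

*ₚ-congˡ : ∀ {p p′} q → p ≈ₚ p′ → (p *ₚ q) ≈ₚ (p′ *ₚ q)
*ₚ-congˡ {p} {p′} q e n = trans (*ₚ-comm p q n) (trans (*ₚ-congʳ q e n) (*ₚ-comm q p′ n))

*ₚ-distribʳ-+ₚ : ∀ r p q → ((p +ₚ q) *ₚ r) ≈ₚ (p *ₚ r +ₚ q *ₚ r)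
*ₚ-distribʳ-+ₚ r []      q       n = refl
*ₚ-distribʳ-+ₚ r (c ∷ p) []      n = sym (coeff-+ₚ ((c ∷ p) *ₚ r) [] n ⟨ trans ⟩ ℚ.+-identityʳ _)
*ₚ-distribʳ-+ₚ r (c ∷ p) (d ∷ q) n = begin
  coeff ((c +ℚ d ∷ p +ₚ q) *ₚ r) n
    ≡⟨ coeff-∷-*ₚ (c +ℚ d) (p +ₚ q) r n ⟩
  (c +ℚ d) *ℚ coeff r n +ℚ coeff (0ℚ ∷ (p +ₚ q) *ₚ r) n
    ≡⟨ cong ((c +ℚ d) *ℚ coeff r n +ℚ_)
            (0∷-cong (*ₚ-distribʳ-+ₚ r p q) n ⟨ trans ⟩ coeff-0∷-+ₚ (p *ₚ r) (q *ₚ r) n) ⟩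
  (c +ℚ d) *ℚ coeff r n +ℚ (coeff (0ℚ ∷ p *ₚ r) n +ℚ coeff (0ℚ ∷ q *ₚ r) n)
    ≡⟨ distrib c d (coeff r n) _ _ ⟩
  (c *ℚ coeff r n +ℚ coeff (0ℚ ∷ p *ₚ r) n) +ℚ (d *ℚ coeff r n +ℚ coeff (0ℚ ∷ q *ₚ r) n)
    ≡⟨ sym (cong₂ _+ℚ_ (coeff-∷-*ₚ c p r n) (coeff-∷-*ₚ d q r n)) ⟩
  coeff ((c ∷ p) *ₚ r) n +ℚ coeff ((d ∷ q) *ₚ r) n
    ≡⟨ sym (coeff-+ₚ ((c ∷ p) *ₚ r) ((d ∷ q) *ₚ r) n) ⟩
  coeff ((c ∷ p) *ₚ r +ₚ (d ∷ q) *ₚ r) n ∎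
  where
  open ≡-Reasoning
  distrib : ∀ c d x y z → (c +ℚ d) *ℚ x +ℚ (y +ℚ z) ≡ (c *ℚ x +ℚ y) +ℚ (d *ℚ x +ℚ z)
  distrib = solve-∀ ℚ-almostCommutativeRing

scale-*ₚ : ∀ c q r → (map (c *ℚ_) q *ₚ r) ≈ₚ map (c *ℚ_) (q *ₚ r)
scale-*ₚ c []      r n = refl
scale-*ₚ c (d ∷ q) r n = begin
  coeff ((c *ℚ d ∷ map (c *ℚ_) q) *ₚ r) n
    ≡⟨ coeff-∷-*ₚ (c *ℚ d) (map (c *ℚ_) q) r n ⟩
  c *ℚ d *ℚ coeff r n +ℚ coeff (0ℚ ∷ map (c *ℚ_) q *ₚ r) n
    ≡⟨ cong (c *ℚ d *ℚ coeff r n +ℚ_)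
            (0∷-cong (scale-*ₚ c q r) n ⟨ trans ⟩ coeff-0∷-scale c (q *ₚ r) n) ⟩
  c *ℚ d *ℚ coeff r n +ℚ c *ℚ coeff (0ℚ ∷ q *ₚ r) n
    ≡⟨ factor c d (coeff r n) _ ⟩
  c *ℚ (d *ℚ coeff r n +ℚ coeff (0ℚ ∷ q *ₚ r) n)
    ≡⟨ cong (c *ℚ_) (sym (coeff-∷-*ₚ d q r n)) ⟨ trans ⟩ sym (coeff-scale c ((d ∷ q) *ₚ r) n) ⟩
  coeff (map (c *ℚ_) ((d ∷ q) *ₚ r)) n ∎
  where
  open ≡-Reasoning
  factor : ∀ c d x y → c *ℚ d *ℚ x +ℚ c *ℚ y ≡ c *ℚ (d *ℚ x +ℚ y)
  factor = solve-∀ ℚ-almostCommutativeRing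

0∷-*ₚ : ∀ p r → ((0ℚ ∷ p) *ₚ r) ≈ₚ (0ℚ ∷ p *ₚ r)
0∷-*ₚ p r n =
  trans (coeff-∷-*ₚ 0ℚ p r n)
        (trans (cong (_+ℚ coeff (0ℚ ∷ p *ₚ r) n) (ℚ.*-zeroˡ (coeff r n))) (ℚ.+-identityˡ _))

*ₚ-assoc : ∀ p q r → ((p *ₚ q) *ₚ r) ≈ₚ (p *ₚ (q *ₚ r))
*ₚ-assoc []      q r n = refl
*ₚ-assoc (c ∷ p) q r n =
  trans (*ₚ-distribʳ-+ₚ r (map (c *ℚ_) q) (0ℚ ∷ p *ₚ q) n)
        (+ₚ-cong {map (c *ℚ_) q *ₚ r} {map (c *ℚ_) (q *ₚ r)} {(0ℚ ∷ p *ₚ q) *ₚ r} {0ℚ ∷ p *ₚ (q *ₚ r)}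
                 (scale-*ₚ c q r) (λ m → trans (0∷-*ₚ (p *ₚ q) r m) (0∷-cong (*ₚ-assoc p q r) m)) n)

*ₚ-identityˡ : ∀ q → ((1ℚ ∷ []) *ₚ q) ≈ₚ q
*ₚ-identityˡ q n =
  trans (coeff-∷-*ₚ 1ℚ [] q n)
        (trans (cong₂ _+ℚ_ (ℚ.*-identityˡ (coeff q n)) (0∷[]-null n)) (ℚ.+-identityʳ _))

-- Wrapping ≈ₚ in a record lets Agda recover both polynomials from an equation,
-- which the ring solver and the divisibility lemmas below rely on.
infix 4 _≋_

record _≋_ (p q : Poly) : Set where
  constructor mk≋
  field coeff-≡ : p ≈ₚ q

open _≋_ public

ℚ[x]-commutativeRing : CommutativeRing 0ℓ 0ℓ
ℚ[x]-commutativeRing = record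
  { Carrier = Poly ; _≈_ = _≋_ ; _+_ = _+ₚ_ ; _*_ = _*ₚ_ ; -_ = negₚ ; 0# = [] ; 1# = 1ℚ ∷ []
  ; isCommutativeRing = record
    { isRing = record
      { +-isAbelianGroup = record
        { isGroup = record
          { isMonoid = record
            { isSemigroup = record
              { isMagma = record
                { isEquivalence = record
                  { refl  = mk≋ λ n → refl
                  ; sym   = λ e → mk≋ λ n → sym (coeff-≡ e n)
                  ; trans = λ e f → mk≋ λ n → trans (coeff-≡ e n) (coeff-≡ f n) }
                ; ∙-cong = λ {p} {p′} {q} {q′} e f → mk≋ (+ₚ-cong {p} {p′} {q} {q′} (coeff-≡ e) (coeff-≡ f)) }
              ; assoc = λ p q r → mk≋ (+ₚ-assoc p q r) }
            ; identity = (λ p → mk≋ λ n → coeff-+ₚ [] p n ⟨ trans ⟩ ℚ.+-identityˡ _)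
                       , (λ p → mk≋ λ n → coeff-+ₚ p [] n ⟨ trans ⟩ ℚ.+-identityʳ _) }
          ; inverse = (λ p → mk≋ λ n → coeff-+ₚ (negₚ p) p n ⟨ trans ⟩
                         cong (_+ℚ coeff p n) (coeff-negₚ p n) ⟨ trans ⟩ ℚ.+-inverseˡ (coeff p n))
                    , (λ p → mk≋ λ n → coeff-+ₚ p (negₚ p) n ⟨ trans ⟩
                         cong (coeff p n +ℚ_) (coeff-negₚ p n) ⟨ trans ⟩ ℚ.+-inverseʳ (coeff p n))
          ; ⁻¹-cong = λ {p} {q} e → mk≋ λ n →
              coeff-negₚ p n ⟨ trans ⟩ cong -ℚ_ (coeff-≡ e n) ⟨ trans ⟩ sym (coeff-negₚ q n) }
        ; comm = λ p q → mk≋ λ n →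
            coeff-+ₚ p q n ⟨ trans ⟩ ℚ.+-comm (coeff p n) (coeff q n) ⟨ trans ⟩ sym (coeff-+ₚ q p n) }
      ; *-cong = λ {p} {p′} {q} {q′} e f → mk≋ λ n →
          trans (*ₚ-congˡ {p} {p′} q (coeff-≡ e) n) (*ₚ-congʳ p′ (coeff-≡ f) n)
      ; *-assoc = λ p q r → mk≋ (*ₚ-assoc p q r)
      ; *-identity = (λ p → mk≋ (*ₚ-identityˡ p))
                   , (λ p → mk≋ λ n → trans (*ₚ-comm p (1ℚ ∷ []) n) (*ₚ-identityˡ p n))
      ; distrib = (λ r p q → mk≋ λ n → *ₚ-comm r (p +ₚ q) n ⟨ trans ⟩ *ₚ-distribʳ-+ₚ r p q n ⟨ trans ⟩
                     +ₚ-cong {p *ₚ r} {r *ₚ p} {q *ₚ r} {r *ₚ q} (*ₚ-comm p r) (*ₚ-comm q r) n)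
                , (λ r p q → mk≋ (*ₚ-distribʳ-+ₚ r p q)) }
    ; *-comm = λ p q → mk≋ (*ₚ-comm p q) } }

null? : ∀ p → Maybe ([] ≋ p)
null? [] = just (mk≋ λ n → refl)
null? (c ∷ p) with 0ℚ ℚ.≟ c | null? p
... | yes c≡0 | just p≋0 = just (mk≋ λ { zero → c≡0 ; (suc n) → coeff-≡ p≋0 n })
... | _       | _        = nothing

ℚ[x]-almostCommutativeRing : AlmostCommutativeRing 0ℓ 0ℓ
ℚ[x]-almostCommutativeRing = fromCommutativeRing ℚ[x]-commutativeRing null?

module ℚ[x] where
  open CommutativeRing ℚ[x]-commutativeRing public
  open import Algebra.Properties.Semiring.Divisibility semiring public
    using (_∣_; _,_; ∣ʳ-respʳ-≈; x∣ʳy⇒x∣ʳzy)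

open ℚ[x] using (_,_; ∣ʳ-respʳ-≈; x∣ʳy⇒x∣ʳzy)

∣-+ₚ : ∀ {w p q} → w ℚ[x].∣ p → w ℚ[x].∣ q → w ℚ[x].∣ (p +ₚ q)
∣-+ₚ {w} (u , uw≋p) (v , vw≋q) = u +ₚ v , ℚ[x].trans (ℚ[x].distribʳ w u v) (ℚ[x].+-cong uw≋p vw≋q)

∣ₚ⇒∣ : ∀ {w p} → w ∣ₚ p → w ℚ[x].∣ p
∣ₚ⇒∣ {w} (v , wv≈p) = v , mk≋ λ n → trans (*ₚ-comm v w n) (wv≈p n)

infix 30 x^_

x^_ : ℕ → Poly
x^ n = mono 1ℚ n

coeff-mono-≡ : ∀ c e → coeff (mono c e) e ≡ c
coeff-mono-≡ c zero    = refl
coeff-mono-≡ c (suc e) = coeff-mono-≡ c e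

coeff-mono-≢ : ∀ c e n → n ≢ e → coeff (mono c e) n ≡ 0ℚ
coeff-mono-≢ c zero    zero    n≢e = ⊥-elim (n≢e refl)
coeff-mono-≢ c zero    (suc n) n≢e = refl
coeff-mono-≢ c (suc e) zero    n≢e = refl
coeff-mono-≢ c (suc e) (suc n) n≢e = coeff-mono-≢ c e n (n≢e ∘ cong suc)

mono-≢0⇒≡ : ∀ c e {n} → coeff (mono c e) n ≢ 0ℚ → n ≡ e
mono-≢0⇒≡ c e {n} nz with n ≟ e
... | yes n≡e = n≡e
... | no  n≢e = ⊥-elim (nz (coeff-mono-≢ c e n n≢e))

mono-+ : ∀ c m n → mono c (m + n) ≋ mono c m *ₚ x^ n
mono-+ c zero    n = mk≋ λ k → sym (begin
  coeff ((c ∷ []) *ₚ x^ n) k               ≡⟨ coeff-∷-*ₚ c [] (x^ n) k ⟩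
  c *ℚ coeff (x^ n) k +ℚ coeff (0ℚ ∷ []) k ≡⟨ cong₂ _+ℚ_ (sym (scaled n k)) (0∷[]-null k) ⟩
  coeff (mono c n) k +ℚ 0ℚ                 ≡⟨ ℚ.+-identityʳ _ ⟩
  coeff (mono c n) k                       ∎)
  where
  open ≡-Reasoning
  scaled : ∀ n k → coeff (mono c n) k ≡ c *ℚ coeff (x^ n) k
  scaled zero    zero    = sym (ℚ.*-identityʳ c)
  scaled zero    (suc k) = sym (ℚ.*-zeroʳ c)
  scaled (suc n) zero    = sym (ℚ.*-zeroʳ c)
  scaled (suc n) (suc k) = scaled n k
mono-+ c (suc m) n = mk≋ λ k →
  trans (0∷-cong (coeff-≡ (mono-+ c m n)) k) (sym (0∷-*ₚ (mono c m) (x^ n) k))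

mono-2* : ∀ c n → mono c (2 * n) ≋ mono c n *ₚ x^ n
mono-2* c n =
  ℚ[x].trans (mono-+ c n (n + 0)) (mk≋ λ k → cong (λ m → coeff (mono c n *ₚ x^ m) k) (+-identityʳ n))

-- Leading and trailing terms

Null-*ₚʳ : ∀ p q → Null q → Null (p *ₚ q)
Null-*ₚʳ p q q≈0 n = trans (*ₚ-congʳ p q≈0 n) (*ₚ-zeroʳ p n)

Null-*ₚˡ : ∀ p q → Null p → Null (p *ₚ q)
Null-*ₚˡ p q p≈0 n = trans (*ₚ-comm p q n) (Null-*ₚʳ q p p≈0 n)

record Leading (p : Poly) (i : ℕ) : Set where
  constructor leading
  field
    nonzero : coeff p i ≢ 0ℚ
    above   : ∀ j → i < j → coeff p j ≡ 0ℚ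

record Trailing (p : Poly) (i : ℕ) : Set where
  constructor trailing
  field
    nonzero : coeff p i ≢ 0ℚ
    below   : ∀ j → j < i → coeff p j ≡ 0ℚ

leading? : ∀ p → ∃ (Leading p) ⊎ Null p
leading? [] = inj₂ λ n → refl
leading? (c ∷ p) with leading? p
... | inj₁ (i , leading nz above) = inj₁ (suc i , leading nz λ { (suc j) (s≤s i<j) → above j i<j })
... | inj₂ p≈0 with c ℚ.≟ 0ℚ
...   | yes c≡0 = inj₂ λ { zero → c≡0 ; (suc n) → p≈0 n }
...   | no  c≢0 = inj₁ (0 , leading c≢0 λ { (suc j) _ → p≈0 j })

trailing? : ∀ p → ∃ (Trailing p) ⊎ Null p
trailing? [] = inj₂ λ n → refl
trailing? (c ∷ p) with c ℚ.≟ 0ℚ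
... | no  c≢0 = inj₁ (0 , trailing c≢0 λ j ())
... | yes c≡0 with trailing? p
...   | inj₁ (i , trailing nz below) =
          inj₁ (suc i , trailing nz λ { zero _ → c≡0 ; (suc j) (s≤s j<i) → below j j<i })
...   | inj₂ p≈0 = inj₂ λ { zero → c≡0 ; (suc n) → p≈0 n }

Leading⇒≤ : ∀ {p i j} → Leading p i → coeff p j ≢ 0ℚ → j ≤ i
Leading⇒≤ (leading _ above) nz = ≮⇒≥ (λ i<j → nz (above _ i<j))

Trailing⇒≤ : ∀ {p i j} → Trailing p i → coeff p j ≢ 0ℚ → i ≤ j
Trailing⇒≤ (trailing _ below) nz = ≮⇒≥ (λ j<i → nz (below _ j<i))

coeff-*ₚ-leading : ∀ p q {i k} → Leading p i → Leading q k →
                   coeff (p *ₚ q) (i + k) ≡ coeff p i *ℚ coeff q k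
coeff-*ₚ-leading []      q (leading nz _) _ = ⊥-elim (nz refl)
coeff-*ₚ-leading (c ∷ p) q {zero} {k} (leading _ above) _ =
  trans (coeff-∷-*ₚ c p q k) (trans (cong (c *ℚ coeff q k +ℚ_) (shifted k)) (ℚ.+-identityʳ _))
  where
  shifted : Null (0ℚ ∷ p *ₚ q)
  shifted zero    = refl
  shifted (suc n) = Null-*ₚˡ p q (λ j → above (suc j) (s≤s z≤n)) n
coeff-*ₚ-leading (c ∷ p) q {suc i} {k} (leading nz above) lq@(leading _ aboveq) =
  trans (coeff-∷-*ₚ c p q (suc (i + k)))
        (trans (cong₂ _+ℚ_ (trans (cong (c *ℚ_) (aboveq _ (s≤s (m≤n+m k i)))) (ℚ.*-zeroʳ c))
                           (coeff-*ₚ-leading p q (leading nz λ j i<j → above (suc j) (s≤s i<j)) lq))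
               (ℚ.+-identityˡ _))

coeff-*ₚ-below-trailing : ∀ p q {k} → Trailing q k → ∀ m → m < k → coeff (p *ₚ q) m ≡ 0ℚ
coeff-*ₚ-below-trailing []      q tq m m<k = refl
coeff-*ₚ-below-trailing (c ∷ p) q tq@(trailing _ below) m m<k =
  trans (coeff-∷-*ₚ c p q m)
        (trans (cong₂ _+ℚ_ (trans (cong (c *ℚ_) (below m m<k)) (ℚ.*-zeroʳ c)) (shifted m m<k))
               (ℚ.+-identityˡ 0ℚ))
  where
  shifted : ∀ m → m < _ → coeff (0ℚ ∷ p *ₚ q) m ≡ 0ℚ
  shifted zero    _   = refl
  shifted (suc m) m<k = coeff-*ₚ-below-trailing p q tq m (<-trans (n<1+n m) m<k)

coeff-*ₚ-trailing : ∀ p q {i k} → Trailing p i → Trailing q k →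
                    coeff (p *ₚ q) (i + k) ≡ coeff p i *ℚ coeff q k
coeff-*ₚ-trailing []      q (trailing nz _) _ = ⊥-elim (nz refl)
coeff-*ₚ-trailing (c ∷ p) q {zero} {k} _ tq =
  trans (coeff-∷-*ₚ c p q k) (trans (cong (c *ℚ coeff q k +ℚ_) (shifted k tq)) (ℚ.+-identityʳ _))
  where
  shifted : ∀ k → Trailing q k → coeff (0ℚ ∷ p *ₚ q) k ≡ 0ℚ
  shifted zero    _  = refl
  shifted (suc k) tq = coeff-*ₚ-below-trailing p q tq k (n<1+n k)
coeff-*ₚ-trailing (c ∷ p) q {suc i} {k} (trailing nz below) tq =
  trans (coeff-∷-*ₚ c p q (suc (i + k)))
        (trans (cong₂ _+ℚ_ (trans (cong (_*ℚ coeff q (suc (i + k))) (below 0 (s≤s z≤n)))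
                                  (ℚ.*-zeroˡ (coeff q (suc (i + k)))))
                           (coeff-*ₚ-trailing p q (trailing nz λ j j<i → below (suc j) (s≤s j<i)) tq))
               (ℚ.+-identityˡ _))

HasTwoTerms : Poly → Set
HasTwoTerms w = ∃ λ i → ∃ λ j → i ≢ j × coeff w i ≢ 0ℚ × coeff w j ≢ 0ℚ

two-terms⇒trailing<leading : ∀ w {s t} → HasTwoTerms w → Trailing w s → Leading w t → s < t
two-terms⇒trailing<leading w (i , j , i≢j , wᵢ≢0 , wⱼ≢0) tw lw with <-cmp i j
... | tri< i<j _ _ = ≤-<-trans (Trailing⇒≤ tw wᵢ≢0) (<-≤-trans i<j (Leading⇒≤ lw wⱼ≢0))
... | tri≈ _ i≡j _ = ⊥-elim (i≢j i≡j)
... | tri> _ _ j<i = ≤-<-trans (Trailing⇒≤ tw wⱼ≢0) (<-≤-trans j<i (Leading⇒≤ lw wᵢ≢0))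

cofactor-nonnull : ∀ v w c n → v *ₚ w ≋ mono c n → c ≢ 0ℚ → ¬ Null v
cofactor-nonnull v w c n vw≋cxⁿ c≢0 v≈0 =
  c≢0 (trans (sym (trans (coeff-≡ vw≋cxⁿ n) (coeff-mono-≡ c n))) (Null-*ₚˡ v w v≈0 n))

two-terms∤mono : ∀ w c n → HasTwoTerms w → c ≢ 0ℚ → ¬ (w ℚ[x].∣ mono c n)
two-terms∤mono w c n two@(i , _ , _ , wᵢ≢0 , _) c≢0 (v , vw≋cxⁿ)
  with leading? w | trailing? w | leading? v | trailing? v
... | inj₂ w≈0 | _        | _        | _        = wᵢ≢0 (w≈0 i)
... | _        | inj₂ w≈0 | _        | _        = wᵢ≢0 (w≈0 i)
... | _        | _        | inj₂ v≈0 | _        = cofactor-nonnull v w c n vw≋cxⁿ c≢0 v≈0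
... | _        | _        | _        | inj₂ v≈0 = cofactor-nonnull v w c n vw≋cxⁿ c≢0 v≈0
... | inj₁ (t , lw) | inj₁ (s , tw) | inj₁ (t′ , lv) | inj₁ (s′ , tv) =
  <-irrefl (trans (degree-n (coeff-*ₚ-trailing v w tv tw) (Trailing.nonzero tv) (Trailing.nonzero tw))
                  (sym (degree-n (coeff-*ₚ-leading v w lv lw) (Leading.nonzero lv) (Leading.nonzero lw))))
           (+-mono-≤-< (Leading⇒≤ lv (Trailing.nonzero tv)) (two-terms⇒trailing<leading w two tw lw))
  where
  degree-n : ∀ {m x y} → coeff (v *ₚ w) m ≡ x *ℚ y → x ≢ 0ℚ → y ≢ 0ℚ → m ≡ n
  degree-n {m} eq x≢0 y≢0 = mono-≢0⇒≡ c n λ cxⁿₘ≡0 →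
    x#0y#0→xy#0 x≢0 y≢0 (trans (sym eq) (trans (coeff-≡ vw≋cxⁿ m) cxⁿₘ≡0))

-- Parts of a polynomial by residue class of exponents

restrict : (ℕ → Bool) → Poly → Poly
restrict ρ []      = []
restrict ρ (c ∷ p) = (if ρ 0 then c else 0ℚ) ∷ restrict (ρ ∘ suc) p

coeff-restrict : ∀ ρ p n → coeff (restrict ρ p) n ≡ (if ρ n then coeff p n else 0ℚ)
coeff-restrict ρ []      n with ρ n
... | true  = refl
... | false = refl
coeff-restrict ρ (c ∷ p) zero    = refl
coeff-restrict ρ (c ∷ p) (suc n) = coeff-restrict (ρ ∘ suc) p n

restrict-cong : ∀ ρ {p q} → p ≈ₚ q → restrict ρ p ≈ₚ restrict ρ q
restrict-cong ρ {p} {q} p≈q n =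
  trans (coeff-restrict ρ p n) (trans (cong (if ρ n then_else 0ℚ) (p≈q n)) (sym (coeff-restrict ρ q n)))

restrict-+ₚ : ∀ ρ p q → restrict ρ (p +ₚ q) ≈ₚ (restrict ρ p +ₚ restrict ρ q)
restrict-+ₚ ρ p q n
  rewrite coeff-+ₚ (restrict ρ p) (restrict ρ q) n | coeff-restrict ρ (p +ₚ q) n
        | coeff-restrict ρ p n | coeff-restrict ρ q n | coeff-+ₚ p q n
  with ρ n
... | true  = refl
... | false = sym (ℚ.+-identityʳ 0ℚ)

restrict-*ₚ : ∀ ρ σ w v → (∀ i → coeff w i ≢ 0ℚ → ∀ m → ρ (i + m) ≡ σ m) →
              restrict ρ (w *ₚ v) ≈ₚ (w *ₚ restrict σ v)
restrict-*ₚ ρ σ []      v shift n = refl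
restrict-*ₚ ρ σ (c ∷ w) v shift n = begin
  coeff (restrict ρ ((c ∷ w) *ₚ v)) n
    ≡⟨ coeff-restrict ρ ((c ∷ w) *ₚ v) n ⟨ trans ⟩ cong (if ρ n then_else 0ℚ) (coeff-∷-*ₚ c w v n) ⟩
  (if ρ n then c *ℚ coeff v n +ℚ coeff (0ℚ ∷ w *ₚ v) n else 0ℚ)
    ≡⟨ split (ρ n) (σ n) (coeff v n) _ c≡0⊎ρₙ≡σₙ ⟩
  c *ℚ (if σ n then coeff v n else 0ℚ) +ℚ (if ρ n then coeff (0ℚ ∷ w *ₚ v) n else 0ℚ)
    ≡⟨ cong₂ _+ℚ_ (cong (c *ℚ_) (sym (coeff-restrict σ v n))) (restricted-tail n) ⟩
  c *ℚ coeff (restrict σ v) n +ℚ coeff (0ℚ ∷ w *ₚ restrict σ v) n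
    ≡⟨ sym (coeff-∷-*ₚ c w (restrict σ v) n) ⟩
  coeff ((c ∷ w) *ₚ restrict σ v) n ∎
  where
  open ≡-Reasoning
  c≡0⊎ρₙ≡σₙ : c ≡ 0ℚ ⊎ ρ n ≡ σ n
  c≡0⊎ρₙ≡σₙ with c ℚ.≟ 0ℚ
  ... | yes c≡0 = inj₁ c≡0
  ... | no  c≢0 = inj₂ (shift 0 c≢0 n)
  split : ∀ b b′ x s → c ≡ 0ℚ ⊎ b ≡ b′ →
          (if b then c *ℚ x +ℚ s else 0ℚ) ≡ c *ℚ (if b′ then x else 0ℚ) +ℚ (if b then s else 0ℚ)
  split true  b′     x s (inj₁ c≡0) rewrite c≡0 =
    cong (_+ℚ s) (trans (ℚ.*-zeroˡ x) (sym (ℚ.*-zeroˡ (if b′ then x else 0ℚ))))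
  split false b′     x s (inj₁ c≡0) rewrite c≡0 =
    sym (trans (ℚ.+-identityʳ _) (ℚ.*-zeroˡ (if b′ then x else 0ℚ)))
  split true  .true  x s (inj₂ refl) = refl
  split false .false x s (inj₂ refl) = sym (trans (ℚ.+-identityʳ _) (ℚ.*-zeroʳ c))
  restricted-tail : ∀ n → (if ρ n then coeff (0ℚ ∷ w *ₚ v) n else 0ℚ) ≡ coeff (0ℚ ∷ w *ₚ restrict σ v) n
  restricted-tail zero    with ρ 0
  ... | true  = refl
  ... | false = refl
  restricted-tail (suc n) =
    trans (sym (coeff-restrict (ρ ∘ suc) (w *ₚ v) n))
          (restrict-*ₚ (ρ ∘ suc) σ w v (λ i wᵢ≢0 → shift (suc i) wᵢ≢0) n)

restrict-id : ∀ ρ p → (∀ n → coeff p n ≢ 0ℚ → T (ρ n)) → restrict ρ p ≈ₚ p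
restrict-id ρ p keep n = trans (coeff-restrict ρ p n) (kept (ρ n) (keep n))
  where
  kept : ∀ b → (coeff p n ≢ 0ℚ → T b) → (if b then coeff p n else 0ℚ) ≡ coeff p n
  kept true  _ = refl
  kept false k with coeff p n ℚ.≟ 0ℚ
  ... | yes pₙ≡0 = sym pₙ≡0
  ... | no  pₙ≢0 = ⊥-elim (k pₙ≢0)

restrict-null : ∀ ρ p → (∀ n → coeff p n ≢ 0ℚ → ¬ T (ρ n)) → Null (restrict ρ p)
restrict-null ρ p drop n = trans (coeff-restrict ρ p n) (dropped (ρ n) (drop n))
  where
  dropped : ∀ b → (coeff p n ≢ 0ℚ → ¬ T b) → (if b then coeff p n else 0ℚ) ≡ 0ℚ
  dropped false _ = refl
  dropped true  k with coeff p n ℚ.≟ 0ℚ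
  ... | yes pₙ≡0 = pₙ≡0
  ... | no  pₙ≢0 = ⊥-elim (k pₙ≢0 _)

-- Unlike sumₚ, Σₚ adds no trailing [], so the part of an explicit list of terms
-- is literally the sum of the polynomials it selects.
Σₚ : List Poly → Poly
Σₚ []           = []
Σₚ (p ∷ [])     = p
Σₚ (p ∷ q ∷ ps) = p +ₚ Σₚ (q ∷ ps)

Σₚ-∷ : ∀ p ps → Σₚ (p ∷ ps) ≈ₚ (p +ₚ Σₚ ps)
Σₚ-∷ p []       n = sym (trans (coeff-+ₚ p [] n) (ℚ.+-identityʳ _))
Σₚ-∷ p (q ∷ ps) n = refl

part : ℕ → List (Poly × ℕ) → Poly
part r ts = Σₚ (map proj₁ (filter (λ t → proj₂ t ≟ r) ts))

module Residues (d : ℕ) .{{_ : NonZero d}} where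

  component : ℕ → Poly → Poly
  component r = restrict (λ n → n % d ≡ᵇ r)

  InClass : ℕ → Poly → Set
  InClass r p = ∀ n → coeff p n ≢ 0ℚ → n % d ≡ r

  ∣-component : ∀ {w p} → (∀ i → coeff w i ≢ 0ℚ → d ∣ i) → w ℚ[x].∣ p → ∀ r → w ℚ[x].∣ component r p
  ∣-component {w} {p} d∣exponents (v , vw≋p) r = component r v , mk≋ λ n → begin
    coeff (component r v *ₚ w) n   ≡⟨ *ₚ-comm (component r v) w n ⟩
    coeff (w *ₚ component r v) n   ≡⟨ sym (restrict-*ₚ ρ ρ w v shift-invariant n) ⟩
    coeff (component r (w *ₚ v)) n ≡⟨ restrict-cong ρ {w *ₚ v} {p} wv≈p n ⟩
    coeff (component r p) n        ∎
    where
    open ≡-Reasoning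
    ρ = λ n → n % d ≡ᵇ r
    shift-invariant : ∀ i → coeff w i ≢ 0ℚ → ∀ m → ρ (i + m) ≡ ρ m
    shift-invariant i wᵢ≢0 m = cong (_≡ᵇ r) (%-remove-+ˡ m (d∣exponents i wᵢ≢0))
    wv≈p : (w *ₚ v) ≈ₚ p
    wv≈p m = trans (*ₚ-comm w v m) (coeff-≡ vw≋p m)

  InClass-mono : ∀ c e → InClass (e % d) (mono c e)
  InClass-mono c e n nz = cong (_% d) (mono-≢0⇒≡ c e nz)

  InClass-resp : ∀ {r p q} → p ≋ q → InClass r q → InClass r p
  InClass-resp p≋q q∈r n pₙ≢0 = q∈r n (pₙ≢0 ∘ trans (coeff-≡ p≋q n))

  component-InClass : ∀ r p → InClass r p → component r p ≈ₚ p
  component-InClass r p p∈r = restrict-id _ p λ n pₙ≢0 → ≡⇒≡ᵇ (n % d) r (p∈r n pₙ≢0)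

  component-InClass-≢ : ∀ r s p → InClass s p → s ≢ r → Null (component r p)
  component-InClass-≢ r s p p∈s s≢r =
    restrict-null _ p λ n pₙ≢0 t → s≢r (trans (sym (p∈s n pₙ≢0)) (≡ᵇ⇒≡ (n % d) r t))

  component-sumₚ : ∀ r ts → All (λ (p , s) → InClass s p) ts →
                   component r (sumₚ (map proj₁ ts)) ≈ₚ part r ts
  component-sumₚ r []             []            n = refl
  component-sumₚ r ((p , s) ∷ ts) (p∈s ∷ ts∈) n with s ≡ᵇ r in s≡ᵇr
  ... | true = begin
    coeff (component r (p +ₚ sumₚ (map proj₁ ts))) n
      ≡⟨ restrict-+ₚ _ p (sumₚ (map proj₁ ts)) n ⟩
    coeff (component r p +ₚ component r (sumₚ (map proj₁ ts))) n
      ≡⟨ +ₚ-cong {component r p} {p} {component r (sumₚ (map proj₁ ts))} {part r ts}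
                 (component-InClass r p (subst (λ s → InClass s p) s≡r p∈s)) (component-sumₚ r ts ts∈) n ⟩
    coeff (p +ₚ part r ts) n
      ≡⟨ sym (Σₚ-∷ p (map proj₁ (filter (λ t → proj₂ t ≟ r) ts)) n) ⟩
    coeff (Σₚ (p ∷ map proj₁ (filter (λ t → proj₂ t ≟ r) ts))) n ∎
    where
    open ≡-Reasoning
    s≡r : s ≡ r
    s≡r = ≡ᵇ⇒≡ s r (subst T (sym s≡ᵇr) _)
  ... | false =
    trans (restrict-+ₚ _ p (sumₚ (map proj₁ ts)) n)
          (trans (coeff-+ₚ (component r p) _ n)
                 (trans (cong₂ _+ℚ_ (component-InClass-≢ r s p p∈s s≢r n) (component-sumₚ r ts ts∈ n))
                        (ℚ.+-identityˡ _)))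
    where
    s≢r : s ≢ r
    s≢r s≡r = subst T s≡ᵇr (≡⇒≡ᵇ s r s≡r)

%-cong-+ : ∀ d .{{_ : NonZero d}} x x′ y y′ → x % d ≡ x′ % d → y % d ≡ y′ % d →
           (x + y) % d ≡ (x′ + y′) % d
%-cong-+ d x x′ y y′ x≡x′ y≡y′ =
  trans (%-distribˡ-+ x y d) (trans (cong₂ (λ u v → (u + v) % d) x≡x′ y≡y′) (sym (%-distribˡ-+ x′ y′ d)))

%-cong-*ˡ : ∀ d .{{_ : NonZero d}} k x x′ → x % d ≡ x′ % d → (k * x) % d ≡ (k * x′) % d
%-cong-*ˡ d k x x′ x≡x′ =
  trans (%-distribˡ-* k x d) (trans (cong (λ u → ((k % d) * u) % d) x≡x′) (sym (%-distribˡ-* k x′ d)))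

-- Qab a b and Rab a b are definitionally P (-1) a b and P 1 a b.
P : ℚ → ℕ → ℕ → Poly
P ε a b = sumₚ ( mono 1ℚ (2 * a + b) ∷ mono 1ℚ (a + 2 * b) ∷ mono 1ℚ a ∷ mono 1ℚ b
               ∷ mono ε (2 * a + 2 * b) ∷ mono ε (2 * a) ∷ mono ε (2 * b) ∷ mono ε 0 ∷ [])

module Parts (ε : ℚ) (a b : ℕ) where

  open Residues 3

  A B E : Poly
  A = x^ a
  B = x^ b
  E = mono ε 0

  -- The terms of P ε a b, each tagged with the residue mod 3 of its exponent when
  -- a ≡ α and b ≡ β; for numerals α, β the tags, hence the parts, compute.
  terms : ℕ → ℕ → List (Poly × ℕ)
  terms α β =
      (A *ₚ A *ₚ B             , (2 * α + β) % 3)     ∷ (A *ₚ (B *ₚ B) , (α + 2 * β) % 3)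
    ∷ (A                       , α % 3)               ∷ (B             , β % 3)
    ∷ (E *ₚ A *ₚ A *ₚ (B *ₚ B) , (2 * α + 2 * β) % 3) ∷ (E *ₚ A *ₚ A   , (2 * α) % 3)
    ∷ (E *ₚ B *ₚ B             , (2 * β) % 3)         ∷ (E             , 0)
    ∷ []

  x^[2a+b] : mono 1ℚ (2 * a + b) ≋ A *ₚ A *ₚ B
  x^[2a+b] = ℚ[x].trans (mono-+ 1ℚ (2 * a) b) (ℚ[x].*-congʳ {B} (mono-2* 1ℚ a))

  x^[a+2b] : mono 1ℚ (a + 2 * b) ≋ A *ₚ (B *ₚ B)
  x^[a+2b] = ℚ[x].trans (mono-+ 1ℚ a (2 * b)) (ℚ[x].*-congˡ {A} (mono-2* 1ℚ b))

  εx^[2n] : ∀ n → mono ε (2 * n) ≋ E *ₚ x^ n *ₚ x^ n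
  εx^[2n] n = ℚ[x].trans (mono-2* ε n) (ℚ[x].*-congʳ {x^ n} (mono-+ ε 0 n))

  εx^[2a+2b] : mono ε (2 * a + 2 * b) ≋ E *ₚ A *ₚ A *ₚ (B *ₚ B)
  εx^[2a+2b] = ℚ[x].trans (mono-+ ε (2 * a) (2 * b)) (ℚ[x].*-cong (εx^[2n] a) (mono-2* 1ℚ b))

  P≋terms : ∀ α β → P ε a b ≋ sumₚ (map proj₁ (terms α β))
  P≋terms α β =
    x^[2a+b] +≋ (x^[a+2b] +≋ (ℚ[x].refl {A} +≋ (ℚ[x].refl {B} +≋
      (εx^[2a+2b] +≋ (εx^[2n] a +≋ (εx^[2n] b +≋ ℚ[x].refl {E +ₚ []}))))))
    where _+≋_ = ℚ[x].+-cong

  terms-InClass : ∀ α β → a % 3 ≡ α % 3 → b % 3 ≡ β % 3 → All (λ (p , s) → InClass s p) (terms α β)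
  terms-InClass α β a≡α b≡β =
      tag 1ℚ (2 * a + b) x^[2a+b] (%-cong-+ 3 (2 * a) (2 * α) b β 2a≡2α b≡β)
    ∷ tag 1ℚ (a + 2 * b) x^[a+2b] (%-cong-+ 3 a α (2 * b) (2 * β) a≡α 2b≡2β)
    ∷ tag 1ℚ a ℚ[x].refl a≡α
    ∷ tag 1ℚ b ℚ[x].refl b≡β
    ∷ tag ε (2 * a + 2 * b) εx^[2a+2b] (%-cong-+ 3 (2 * a) (2 * α) (2 * b) (2 * β) 2a≡2α 2b≡2β)
    ∷ tag ε (2 * a) (εx^[2n] a) 2a≡2α
    ∷ tag ε (2 * b) (εx^[2n] b) 2b≡2β
    ∷ tag ε 0 ℚ[x].refl refl
    ∷ []
    where
    2a≡2α = %-cong-*ˡ 3 2 a α a≡α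
    2b≡2β = %-cong-*ˡ 3 2 b β b≡β
    tag : ∀ c e {p s} → mono c e ≋ p → e % 3 ≡ s → InClass s p
    tag c e cxᵉ≋p e≡s =
      InClass-resp (ℚ[x].sym cxᵉ≋p) (subst (λ s → InClass s (mono c e)) e≡s (InClass-mono c e))

  ∣-part : ∀ {W} → (∀ i → coeff W i ≢ 0ℚ → 3 ∣ i) → W ℚ[x].∣ P ε a b →
           ∀ α β → a % 3 ≡ α % 3 → b % 3 ≡ β % 3 → ∀ r → W ℚ[x].∣ part r (terms α β)
  ∣-part 3∣exponents W∣P α β a≡α b≡β r =
    ∣ʳ-respʳ-≈ (mk≋ (component-sumₚ r (terms α β) (terms-InClass α β a≡α b≡β)))
               (∣-component 3∣exponents (∣ʳ-respʳ-≈ (P≋terms α β) W∣P) r)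

  ∣x^[a+b]-when-3∣b : ∀ {W} → W ℚ[x].∣ (B +ₚ (E *ₚ B *ₚ B +ₚ E)) → W ℚ[x].∣ (A *ₚ (B *ₚ B) +ₚ A) →
                      W ℚ[x].∣ x^ (a + b)
  ∣x^[a+b]-when-3∣b r₀ r₁ =
    ∣ʳ-respʳ-≈ (ℚ[x].trans (identity A B E) (ℚ[x].sym (mono-+ 1ℚ a b)))
               (∣-+ₚ (x∣ʳy⇒x∣ʳzy A r₀) (x∣ʳy⇒x∣ʳzy (negₚ E) r₁))
    where
    identity : ∀ x y e → x *ₚ (y +ₚ (e *ₚ y *ₚ y +ₚ e)) +ₚ negₚ e *ₚ (x *ₚ (y *ₚ y) +ₚ x) ≋ x *ₚ y
    identity = solve-∀ ℚ[x]-almostCommutativeRing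

  ∣x^[a+b]-when-3∣a : ∀ {W} → W ℚ[x].∣ (A +ₚ (E *ₚ A *ₚ A +ₚ E)) → W ℚ[x].∣ (A *ₚ A *ₚ B +ₚ B) →
                      W ℚ[x].∣ x^ (a + b)
  ∣x^[a+b]-when-3∣a r₀ r₁ =
    ∣ʳ-respʳ-≈ (ℚ[x].trans (identity A B E) (ℚ[x].sym (mono-+ 1ℚ a b)))
               (∣-+ₚ (x∣ʳy⇒x∣ʳzy B r₀) (x∣ʳy⇒x∣ʳzy (negₚ E) r₁))
    where
    identity : ∀ x y e → y *ₚ (x +ₚ (e *ₚ x *ₚ x +ₚ e)) +ₚ negₚ e *ₚ (x *ₚ x *ₚ y +ₚ y) ≋ x *ₚ y
    identity = solve-∀ ℚ[x]-almostCommutativeRing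

  module _ (ε²≡1 : ε *ℚ ε ≡ 1ℚ) where

    ε²-vanishes : ∀ p z → p +ₚ (E *ₚ E *ₚ z +ₚ negₚ z) ≋ p
    ε²-vanishes p z = begin
      p +ₚ (E *ₚ E *ₚ z +ₚ negₚ z) ≈⟨ ℚ[x].+-congˡ {p} (ℚ[x].+-congʳ {negₚ z} E²z≋z) ⟩
      p +ₚ (z +ₚ negₚ z)           ≈⟨ ℚ[x].+-congˡ {p} (ℚ[x].-‿inverseʳ z) ⟩
      p +ₚ []                      ≈⟨ ℚ[x].+-identityʳ p ⟩
      p                            ∎
      where
      open ≈-Reasoning ℚ[x].setoid
      E²≋1 : E *ₚ E ≋ 1ℚ ∷ []
      E²≋1 = mk≋ λ { zero → trans (ℚ.+-identityʳ _) ε²≡1 ; (suc n) → refl }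
      E²z≋z : E *ₚ E *ₚ z ≋ z
      E²z≋z = ℚ[x].trans (ℚ[x].*-congʳ {z} E²≋1) (ℚ[x].*-identityˡ z)

    ∣x^[2b]-when-a≡b : ∀ {W} → W ℚ[x].∣ (A *ₚ A *ₚ B +ₚ (A *ₚ (B *ₚ B) +ₚ E)) →
                       W ℚ[x].∣ (A +ₚ (B +ₚ E *ₚ A *ₚ A *ₚ (B *ₚ B))) →
                       W ℚ[x].∣ (E *ₚ A *ₚ A +ₚ E *ₚ B *ₚ B) → W ℚ[x].∣ x^ (2 * b)
    ∣x^[2b]-when-a≡b r₀ r₁ r₂ =
      ∣ʳ-respʳ-≈ (ℚ[x].trans (identity A B E)
                             (ℚ[x].trans (ε²-vanishes (B *ₚ B) (A *ₚ A)) (ℚ[x].sym (mono-2* 1ℚ b))))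
                 (∣-+ₚ (∣-+ₚ (x∣ʳy⇒x∣ʳzy (B +ₚ negₚ A) r₁) (x∣ʳy⇒x∣ʳzy (E *ₚ A *ₚ A) r₀))
                       (x∣ʳy⇒x∣ʳzy (negₚ (A *ₚ A *ₚ B)) r₂))
      where
      identity : ∀ x y e →
          (y +ₚ negₚ x) *ₚ (x +ₚ (y +ₚ e *ₚ x *ₚ x *ₚ (y *ₚ y)))
        +ₚ e *ₚ x *ₚ x *ₚ (x *ₚ x *ₚ y +ₚ (x *ₚ (y *ₚ y) +ₚ e))
        +ₚ negₚ (x *ₚ x *ₚ y) *ₚ (e *ₚ x *ₚ x +ₚ e *ₚ y *ₚ y)
        ≋ y *ₚ y +ₚ (e *ₚ e *ₚ (x *ₚ x) +ₚ negₚ (x *ₚ x))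
      identity = solve-∀ ℚ[x]-almostCommutativeRing

    ∣x^[a+2b]-when-a≡-b : ∀ {W} → W ℚ[x].∣ (A *ₚ A *ₚ B +ₚ (A +ₚ E *ₚ B *ₚ B)) →
                          W ℚ[x].∣ (A *ₚ (B *ₚ B) +ₚ (B +ₚ E *ₚ A *ₚ A)) →
                          W ℚ[x].∣ (E *ₚ A *ₚ A *ₚ (B *ₚ B) +ₚ E) → W ℚ[x].∣ x^ (a + 2 * b)
    ∣x^[a+2b]-when-a≡-b r₁ r₂ r₀ =
      ∣ʳ-respʳ-≈ (ℚ[x].trans (identity A B E)
                             (ℚ[x].trans (ε²-vanishes (A *ₚ (B *ₚ B))
                                                      (E *ₚ A *ₚ A +ₚ negₚ (A *ₚ A *ₚ B *ₚ B *ₚ B)))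
                                         (ℚ[x].sym x^[a+2b])))
                 (∣-+ₚ (∣-+ₚ (x∣ʳy⇒x∣ʳzy (A *ₚ B +ₚ E *ₚ E) r₂) (x∣ʳy⇒x∣ʳzy (negₚ (E *ₚ B)) r₀))
                       (x∣ʳy⇒x∣ʳzy (negₚ (E *ₚ A)) r₁))
      where
      identity : ∀ x y e →
          (x *ₚ y +ₚ e *ₚ e) *ₚ (x *ₚ (y *ₚ y) +ₚ (y +ₚ e *ₚ x *ₚ x))
        +ₚ negₚ (e *ₚ y) *ₚ (e *ₚ x *ₚ x *ₚ (y *ₚ y) +ₚ e)
        +ₚ negₚ (e *ₚ x) *ₚ (x *ₚ x *ₚ y +ₚ (x +ₚ e *ₚ y *ₚ y))
        ≋ x *ₚ (y *ₚ y) +ₚ (e *ₚ e *ₚ (e *ₚ x *ₚ x +ₚ negₚ (x *ₚ x *ₚ y *ₚ y *ₚ y))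
                            +ₚ negₚ (e *ₚ x *ₚ x +ₚ negₚ (x *ₚ x *ₚ y *ₚ y *ₚ y)))
      identity = solve-∀ ℚ[x]-almostCommutativeRing

residue-cases : ∀ n → n % 3 ≡ 0 ⊎ n % 3 ≡ 1 ⊎ n % 3 ≡ 2
residue-cases n with n % 3 | m%n<n n 3
... | 0                 | _                  = inj₁ refl
... | 1                 | _                  = inj₂ (inj₁ refl)
... | 2                 | _                  = inj₂ (inj₂ refl)
... | suc (suc (suc _)) | s≤s (s≤s (s≤s ()))

module _ {ε a b} (W : Poly) (ε²≡1 : ε *ℚ ε ≡ 1ℚ) (two : HasTwoTerms W)
         (3∣exponents : ∀ i → coeff W i ≢ 0ℚ → 3 ∣ i) (W∣P : W ℚ[x].∣ P ε a b) where

  open Parts ε a b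

  private
    ∣part : ∀ α β → a % 3 ≡ α % 3 → b % 3 ≡ β % 3 → ∀ r → W ℚ[x].∣ part r (terms α β)
    ∣part = ∣-part 3∣exponents W∣P

    ∤x^ : ∀ n → ¬ W ℚ[x].∣ x^ n
    ∤x^ n = two-terms∤mono W 1ℚ n two ℚ.1≢0

  3∣a×3∣b : 3 ∣ a × 3 ∣ b
  3∣a×3∣b with residue-cases a | residue-cases b
  ... | inj₁ a≡0        | inj₁ b≡0        = m%n≡0⇒n∣m a 3 a≡0 , m%n≡0⇒n∣m b 3 b≡0
  ... | inj₂ (inj₁ a≡1) | inj₁ b≡0        = let p = ∣part 1 0 a≡1 b≡0 in
    ⊥-elim (∤x^ (a + b) (∣x^[a+b]-when-3∣b (p 0) (p 1)))
  ... | inj₂ (inj₂ a≡2) | inj₁ b≡0        = let p = ∣part 2 0 a≡2 b≡0 in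
    ⊥-elim (∤x^ (a + b) (∣x^[a+b]-when-3∣b (p 0) (p 2)))
  ... | inj₁ a≡0        | inj₂ (inj₁ b≡1) = let p = ∣part 0 1 a≡0 b≡1 in
    ⊥-elim (∤x^ (a + b) (∣x^[a+b]-when-3∣a (p 0) (p 1)))
  ... | inj₁ a≡0        | inj₂ (inj₂ b≡2) = let p = ∣part 0 2 a≡0 b≡2 in
    ⊥-elim (∤x^ (a + b) (∣x^[a+b]-when-3∣a (p 0) (p 2)))
  ... | inj₂ (inj₁ a≡1) | inj₂ (inj₁ b≡1) = let p = ∣part 1 1 a≡1 b≡1 in
    ⊥-elim (∤x^ (2 * b) (∣x^[2b]-when-a≡b ε²≡1 (p 0) (p 1) (p 2)))
  ... | inj₂ (inj₂ a≡2) | inj₂ (inj₂ b≡2) = let p = ∣part 2 2 a≡2 b≡2 in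
    ⊥-elim (∤x^ (2 * b) (∣x^[2b]-when-a≡b ε²≡1 (p 0) (p 2) (p 1)))
  ... | inj₂ (inj₁ a≡1) | inj₂ (inj₂ b≡2) = let p = ∣part 1 2 a≡1 b≡2 in
    ⊥-elim (∤x^ (a + 2 * b) (∣x^[a+2b]-when-a≡-b ε²≡1 (p 1) (p 2) (p 0)))
  ... | inj₂ (inj₂ a≡2) | inj₂ (inj₁ b≡1) = let p = ∣part 2 1 a≡2 b≡1 in
    ⊥-elim (∤x^ (a + 2 * b) (∣x^[a+2b]-when-a≡-b ε²≡1 (p 2) (p 1) (p 0)))

lemma6p8 : (a b : ℕ) → 1 ≤ a → 1 ≤ b → (W : Poly)
    → (∃ λ i → ∃ λ j → i ≢ j × coeff W i ≢ 0ℚ × coeff W j ≢ 0ℚ)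
    → (∀ i → coeff W i ≢ 0ℚ → 3 ∣ i)
    → (W ∣ₚ Qab a b) ⊎ (W ∣ₚ Rab a b)
    → (3 ∣ a) × (3 ∣ b)
lemma6p8 a b _ _ W two 3∣exponents (inj₁ W∣Q) = 3∣a×3∣b W refl two 3∣exponents (∣ₚ⇒∣ W∣Q)
lemma6p8 a b _ _ W two 3∣exponents (inj₂ W∣R) = 3∣a×3∣b W refl two 3∣exponents (∣ₚ⇒∣ W∣R)
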